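{- Let $T$ be a semi-complete digraph and $k$ an integer. If $T$ contains a $(5k+2,k)$-degree tangle, then $\mathbf{pw}(T)>k$.
   Context: All digraphs are simple. A digraph $T$ is semi-complete if for every two distinct vertices $v,w$ at least one of the arcs $(v,w)$, $(w,v)$ is present. $d^+(v)$ is the outdegree of $v$. A $(k,\ell)$-degree tangle is a set $X\subseteq V(T)$ with $|X|\ge k$ and $|d^+(v)-d^+(w)|\le\ell$ for all $v,w\in X$. A path decomposition of a digraph $G=(V,E)$ is a sequence $(W_1,\dots,W_r)$ of subsets of $V$ such that (i) $\bigcup_i W_i=V$; (ii) $W_i\cap W_k\subseteq W_j$ for $1\le i<j<k\le r$; (iii) for every arc $(u,v)\in E$, either $u,v\in W_i$ for some $i$, or $u\in W_i$, $v\in W_j$ for some $i>j$. Its width is $\max_i(|W_i|-1)$ and $\mathbf{pw}(G)$ is the minimum width of a path decomposition of $G$. -}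

module Defs where

open import Data.Nat using (ℕ; suc; _≤_; _<_; _⊔_) renaming (∣_-_∣ to dist)
open import Data.Integer using (ℤ; +_)
import Data.Integer as ℤ
open import Data.Bool using (Bool; true; false)
open import Data.Fin using (Fin)
open import Data.Fin.Subset using (Subset; _∈_; ∣_∣)
open import Data.Vec using (tabulate)
open import Data.List using (foldr; map; allFin)
open import Data.Product using (Σ; ∃; ∃-syntax; _×_)
open import Data.Sum using (_⊎_)
open import Relation.Binary.PropositionalEquality using (_≡_; _≢_)
open import Relation.Nullary using (¬_)

record Digraph (n : ℕ) : Set where
  field
    arc     : Fin n → Fin n → Bool
    loopless : ∀ v → arc v v ≡ false
open Digraph public

Arc : ∀ {n} → Digraph n → Fin n → Fin n → Set
Arc G u v = arc G u v ≡ true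

SemiComplete : ∀ {n} → Digraph n → Set
SemiComplete G = ∀ v w → v ≢ w → Arc G v w ⊎ Arc G w v

outNbhd : ∀ {n} → Digraph n → Fin n → Subset n
outNbhd G v = tabulate (arc G v)

outdeg : ∀ {n} → Digraph n → Fin n → ℕ
outdeg G v = ∣ outNbhd G v ∣

IsDegreeTangle : ∀ {n} → Digraph n → ℕ → ℕ → Subset n → Set
IsDegreeTangle G k ℓ X =
  k ≤ ∣ X ∣ × (∀ v w → v ∈ X → w ∈ X → dist (outdeg G v) (outdeg G w) ≤ ℓ)

HasDegreeTangle : ∀ {n} → Digraph n → ℕ → ℕ → Set
HasDegreeTangle G k ℓ = ∃[ X ] IsDegreeTangle G k ℓ X

record PathDecomposition {n} (G : Digraph n) : Set where
  field
    r      : ℕ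
    bag    : Fin (suc r) → Subset n
    cover  : ∀ v → ∃[ i ] v ∈ bag i
    interp : ∀ i j l → i Data.Fin.< j → j Data.Fin.< l →
             ∀ v → v ∈ bag i → v ∈ bag l → v ∈ bag j
    arcs   : ∀ u v → Arc G u v →
             (∃[ i ] (u ∈ bag i × v ∈ bag i)) ⊎
             (∃[ i ] ∃[ j ] (j Data.Fin.< i × u ∈ bag i × v ∈ bag j))
open PathDecomposition public

maxBagSize : ∀ {n} {G : Digraph n} → PathDecomposition G → ℕ
maxBagSize D = foldr _⊔_ 0 (map (λ i → ∣ bag D i ∣) (allFin (suc (r D))))

width : ∀ {n} {G : Digraph n} → PathDecomposition G → ℤ
width D = + maxBagSize D ℤ.- + 1

IsPathwidth : ∀ {n} → Digraph n → ℤ → Set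
IsPathwidth G p =
  (∃[ D ] width {G = G} D ≡ p) × (∀ (D : PathDecomposition G) → p ℤ.≤ width D)

module Submission where

-- Suppose T had a path decomposition (W₀, …, W_r) whose bags have at most
-- k + 1 vertices.  Let e be the earliest index at which some v ∈ X occurs for
-- the last time (the pivot), L the vertices occurring only in bags up to W_e,
-- and B the vertices of X occurring only after W_e.  Arcs of a path
-- decomposition never point forward, so
--   * N⁺(v) ⊆ (L - v) ∪ (W_e - v), whence d⁺(v) + 1 ≤ |L| + k;
--   * X ⊆ W_e ∪ B, whence |B| ≥ 4k + 1;
--   * every w ∈ B dominates L (T is semicomplete), whence d⁺(w) ≥ |L| + |N⁺(w) ∩ B|.
-- By averaging, some w ∈ B beats half of B, so |N⁺(w) ∩ B| ≥ 2k and
-- d⁺(w) ≥ d⁺(v) + k + 1, contradicting the tangle condition |d⁺(v) - d⁺(w)| ≤ k.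

open import Defs
open import Data.Nat using (ℕ; _+_; _*_)

open import Data.Bool using (Bool; true)
import Data.Bool as Bool
open import Data.Empty using (⊥; ⊥-elim)
open import Data.Fin as Fin using (Fin; zero; suc; _≟_)
open import Data.Fin.Properties using (any?; all?; ≤∧≢⇒<)
open import Data.Fin.Subset using (Subset; _∈_; _∉_; ∣_∣; _∪_; _∩_; _-_; ⁅_⁆; Empty; Nonempty; inside; outside) renaming (⊥ to ∅)
open import Data.Fin.Subset.Properties using (_∈?_; nonempty?; p⊆q⇒∣p∣≤∣q∣; x∈p⇒∣p-x∣<∣p∣; x∈p∧x≢y⇒x∈p-y; x∈p∪q⁺; x∈p∪q⁻; x∈p∩q⁺; x∈p∩q⁻; p─q⊆p; Empty-unique; ∣⊥∣≡0; ∣⁅x⁆∣≡1; x∈⁅x⁆)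
import Data.Integer as ℤ
import Data.Integer.Properties as ℤ
open import Data.List using (List; []; _∷_; length; filter; allFin; foldr)
open import Data.List.Properties using (filter-reject)
import Data.List.Membership.Propositional as List
open import Data.List.Membership.Propositional using (find)
open import Data.List.Membership.Propositional.Properties using (∈-filter⁺; ∈-filter⁻; ∈-allFin; ∈-map⁺)
open import Data.List.Relation.Unary.All using (All; []; _∷_)
import Data.List.Relation.Unary.All as All
open import Data.List.Relation.Unary.All.Properties using (¬Any⇒All¬)
open import Data.List.Relation.Unary.Any using (here; there)
import Data.List.Relation.Unary.Any as Any
open import Data.List.Relation.Unary.Any.Properties using (¬Any[])
open import Data.List.Relation.Unary.Unique.Propositional using (Unique; []; _∷_)
open import Data.List.Relation.Unary.Unique.Propositional.Properties using (filter⁺; allFin⁺)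
open import Data.Nat using (zero; suc; _⊔_; _≤_; _≤?_; z≤n; s≤s) renaming (∣_-_∣ to dist)
import Data.Nat as ℕ
open import Data.Nat.Properties using (≤-refl; ≤-trans; ≤-reflexive; ≤-pred; <⇒≤; <⇒≱; ≰⇒>; ≮⇒≥; <-irrefl; m≤n⇒m≤1+n; m≤m+n; m≤n+m; m≤m⊔n; m≤n⊔m; m≤n+∣n-m∣; +-suc; +-identityʳ; +-monoˡ-≤; +-monoʳ-≤; +-mono-≤; +-monoˡ-<; +-cancelˡ-≤; +-cancelʳ-≤; *-monoʳ-≤; *-cancelˡ-≤; +-commutativeSemigroup; module ≤-Reasoning)
open import Algebra.Properties.CommutativeSemigroup +-commutativeSemigroup using (x∙yz≈y∙xz)
open import Data.Nat.Tactic.RingSolver using (solve-∀)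
open import Data.Product using (∃-syntax; _×_; _,_; proj₁; proj₂)
open import Data.Sum using (_⊎_; inj₁; inj₂; [_,_])
import Data.Sum as Sum
open import Data.Vec using ([]; _∷_; here; there; tabulate)
open import Data.Vec.Properties using (lookup∘tabulate; []=⇒lookup; lookup⇒[]=)
open import Function using (_∘_)
open import Relation.Binary.PropositionalEquality using (_≡_; _≢_; refl; sym; trans; cong; cong₂; subst; ≢-sym; module ≡-Reasoning)
open import Relation.Nullary using (¬_; Dec; yes; no; contradiction)
open import Relation.Nullary.Decidable using (does; dec-true; _×-dec_; _→-dec_; ¬?)
open import Relation.Unary using (Pred; Decidable)

∈-tabulate⁺ : ∀ {n} {f : Fin n → Bool} {x} → f x ≡ true → x ∈ tabulate f
∈-tabulate⁺ {f = f} {x} fx = lookup⇒[]= x _ (trans (lookup∘tabulate f x) fx)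

∈-tabulate⁻ : ∀ {n} {f : Fin n → Bool} {x} → x ∈ tabulate f → f x ≡ true
∈-tabulate⁻ {f = f} {x} x∈ = trans (sym (lookup∘tabulate f x)) ([]=⇒lookup x∈)

⟦_⟧ : ∀ {n p} {P : Pred (Fin n) p} → Decidable P → Subset n
⟦ P? ⟧ = tabulate (λ x → does (P? x))

module _ {n p} {P : Pred (Fin n) p} (P? : Decidable P) where

  ∈⟦⟧⁺ : ∀ {x} → P x → x ∈ ⟦ P? ⟧
  ∈⟦⟧⁺ {x} px = ∈-tabulate⁺ (dec-true (P? x) px)

  ∈⟦⟧⁻ : ∀ {x} → x ∈ ⟦ P? ⟧ → P x
  ∈⟦⟧⁻ {x} x∈ with P? x | ∈-tabulate⁻ {f = λ y → does (P? y)} x∈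
  ... | yes px | _ = px
  ... | no _   | ()

∣p∪q∣+∣p∩q∣≡∣p∣+∣q∣ : ∀ {n} (p q : Subset n) → ∣ p ∪ q ∣ + ∣ p ∩ q ∣ ≡ ∣ p ∣ + ∣ q ∣
∣p∪q∣+∣p∩q∣≡∣p∣+∣q∣ []            []            = refl
∣p∪q∣+∣p∩q∣≡∣p∣+∣q∣ (inside  ∷ p) (inside  ∷ q) = cong suc (trans (+-suc ∣ p ∪ q ∣ ∣ p ∩ q ∣)
  (trans (cong suc (∣p∪q∣+∣p∩q∣≡∣p∣+∣q∣ p q)) (sym (+-suc ∣ p ∣ ∣ q ∣))))
∣p∪q∣+∣p∩q∣≡∣p∣+∣q∣ (inside  ∷ p) (outside ∷ q) = cong suc (∣p∪q∣+∣p∩q∣≡∣p∣+∣q∣ p q)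
∣p∪q∣+∣p∩q∣≡∣p∣+∣q∣ (outside ∷ p) (inside  ∷ q) =
  trans (cong suc (∣p∪q∣+∣p∩q∣≡∣p∣+∣q∣ p q)) (sym (+-suc ∣ p ∣ ∣ q ∣))
∣p∪q∣+∣p∩q∣≡∣p∣+∣q∣ (outside ∷ p) (outside ∷ q) = ∣p∪q∣+∣p∩q∣≡∣p∣+∣q∣ p q

∣p∪q∣≤∣p∣+∣q∣ : ∀ {n} (p q : Subset n) → ∣ p ∪ q ∣ ≤ ∣ p ∣ + ∣ q ∣
∣p∪q∣≤∣p∣+∣q∣ p q = ≤-trans (m≤m+n ∣ p ∪ q ∣ ∣ p ∩ q ∣) (≤-reflexive (∣p∪q∣+∣p∩q∣≡∣p∣+∣q∣ p q))

∣p∣+∣q∣≡∣p∪q∣ : ∀ {n} (p q : Subset n) → Empty (p ∩ q) → ∣ p ∣ + ∣ q ∣ ≡ ∣ p ∪ q ∣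
∣p∣+∣q∣≡∣p∪q∣ {n} p q disjoint = begin
  ∣ p ∣ + ∣ q ∣           ≡⟨ sym (∣p∪q∣+∣p∩q∣≡∣p∣+∣q∣ p q) ⟩
  ∣ p ∪ q ∣ + ∣ p ∩ q ∣   ≡⟨ cong (λ c → ∣ p ∪ q ∣ + ∣ c ∣) (Empty-unique disjoint) ⟩
  ∣ p ∪ q ∣ + ∣ ∅ {n} ∣   ≡⟨ cong (_+_ ∣ p ∪ q ∣) (∣⊥∣≡0 n) ⟩
  ∣ p ∪ q ∣ + 0           ≡⟨ +-identityʳ ∣ p ∪ q ∣ ⟩
  ∣ p ∪ q ∣               ∎
  where open ≡-Reasoning

x∉p-x : ∀ {n} (p : Subset n) (x : Fin n) → x ∉ p - x
x∉p-x (_ ∷ p) zero    ()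
x∉p-x (_ ∷ p) (suc x) (there x∈) = x∉p-x p x x∈

length≤∣p∣ : ∀ {n} {p : Subset n} {xs : List (Fin n)} → Unique xs → All (_∈ p) xs → length xs ≤ ∣ p ∣
length≤∣p∣ []                 []               = z≤n
length≤∣p∣ {p = p} {x ∷ xs} (x≢xs ∷ unique) (x∈p ∷ xs⊆p) = begin-strict
  length xs   ≤⟨ length≤∣p∣ unique xs⊆p-x ⟩
  ∣ p - x ∣   <⟨ x∈p⇒∣p-x∣<∣p∣ x∈p ⟩
  ∣ p ∣       ∎
  where
    open ≤-Reasoning
    xs⊆p-x : All (_∈ p - x) xs
    xs⊆p-x = All.zipWith (λ (x≢y , y∈p) → x∈p∧x≢y⇒x∈p-y y∈p (≢-sym x≢y)) (x≢xs , xs⊆p)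

∣p∣≤length : ∀ {n} (p : Subset n) (xs : List (Fin n)) → (∀ {x} → x ∈ p → x List.∈ xs) → ∣ p ∣ ≤ length xs
∣p∣≤length {n} p [] p⊆[] =
  ≤-reflexive (trans (cong ∣_∣ (Empty-unique λ (_ , x∈p) → ¬Any[] (p⊆[] x∈p))) (∣⊥∣≡0 n))
∣p∣≤length p (x ∷ xs) p⊆x∷xs = begin
  ∣ p ∣                 ≤⟨ p⊆q⇒∣p∣≤∣q∣ split ⟩
  ∣ ⁅ x ⁆ ∪ (p - x) ∣   ≤⟨ ∣p∪q∣≤∣p∣+∣q∣ ⁅ x ⁆ (p - x) ⟩
  ∣ ⁅ x ⁆ ∣ + ∣ p - x ∣ ≡⟨ cong (λ s → s + ∣ p - x ∣) (∣⁅x⁆∣≡1 x) ⟩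
  suc ∣ p - x ∣         ≤⟨ s≤s (∣p∣≤length (p - x) xs rest) ⟩
  suc (length xs)       ∎
  where
    open ≤-Reasoning
    split : ∀ {y} → y ∈ p → y ∈ ⁅ x ⁆ ∪ (p - x)
    split {y} y∈p with y ≟ x
    ... | yes refl = x∈p∪q⁺ (inj₁ (x∈⁅x⁆ x))
    ... | no y≢x   = x∈p∪q⁺ (inj₂ (x∈p∧x≢y⇒x∈p-y y∈p y≢x))
    rest : ∀ {y} → y ∈ p - x → y List.∈ xs
    rest y∈ with p⊆x∷xs (p─q⊆p p ⁅ x ⁆ y∈)
    ... | here refl = contradiction y∈ (x∉p-x p x)
    ... | there y∈xs = y∈xs

nonempty : ∀ {n} (p : Subset n) → 1 ≤ ∣ p ∣ → Nonempty p
nonempty {n} p 1≤∣p∣ with nonempty? p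
... | yes inhabited = inhabited
... | no empty      = contradiction (subst (1 ≤_) ∣p∣≡0 1≤∣p∣) λ ()
  where
    ∣p∣≡0 : ∣ p ∣ ≡ 0
    ∣p∣≡0 = trans (cong ∣_∣ (Empty-unique empty)) (∣⊥∣≡0 n)

least : ∀ {m p} {P : Pred (Fin m) p} → Decidable P → ∃[ i ] P i → ∃[ i ] P i × (∀ j → P j → i Fin.≤ j)
least P? (zero , p0) = zero , p0 , λ _ _ → z≤n
least P? (suc i , pi) with P? zero
... | yes p0 = zero , p0 , λ _ _ → z≤n
... | no ¬p0 with least (λ j → P? (suc j)) (i , pi)
...   | l , pl , l-least = suc l , pl , λ { zero p0 → contradiction p0 ¬p0 ; (suc j) pj → s≤s (l-least j pj) }

greatest : ∀ {m p} {P : Pred (Fin m) p} → Decidable P → ∃[ i ] P i → ∃[ i ] P i × (∀ j → P j → j Fin.≤ i)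
greatest {suc m} P? (i , pi) with any? (λ j → P? (suc j))
... | yes later with greatest (λ j → P? (suc j)) later
...   | g , pg , g-greatest = suc g , pg , λ { zero _ → z≤n ; (suc j) pj → s≤s (g-greatest j pj) }
greatest {suc m} P? (zero , p0)  | no ¬later =
  zero , p0 , λ { zero _ → z≤n ; (suc j) pj → contradiction (j , pj) ¬later }
greatest {suc m} P? (suc i , pi) | no ¬later = contradiction (i , pi) ¬later

length≤filter+filter : ∀ {A : Set} {P Q : A → Set} (P? : ∀ x → Dec (P x)) (Q? : ∀ x → Dec (Q x)) {xs} →
                       All (λ x → P x ⊎ Q x) xs → length xs ≤ length (filter P? xs) + length (filter Q? xs)
length≤filter+filter P? Q? [] = z≤n
length≤filter+filter P? Q? {x ∷ xs} (px⊎qx ∷ rest)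
  with ih ← length≤filter+filter P? Q? rest | P? x | Q? x | px⊎qx
... | yes _ | yes _ | _ = s≤s (≤-trans ih (+-monoʳ-≤ _ (m≤n⇒m≤1+n ≤-refl)))
... | yes _ | no _  | _ = s≤s ih
... | no _  | yes _ | _ = ≤-trans (s≤s ih) (≤-reflexive (sym (+-suc _ _)))
... | no ¬p | no _  | inj₁ p = contradiction p ¬p
... | no _  | no ¬q | inj₂ q = contradiction q ¬q

-- Averaging in a semicomplete irreflexive relation R on a list of m distinct
-- elements: the out-degrees sum to at least m(m-1)/2, so some element beats
-- at least half of the others.
module Averaging {A : Set} {R : A → A → Set} (R? : ∀ x y → Dec (R x y)) where

  SemiCompleteOn : List A → Set
  SemiCompleteOn zs = ∀ {x y} → x List.∈ zs → y List.∈ zs → x ≢ y → R x y ⊎ R y x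

  outdegIn : A → List A → ℕ
  outdegIn w zs = length (filter (R? w) zs)

  indegIn : A → List A → ℕ
  indegIn x zs = length (filter (λ w → R? w x) zs)

  arcsFrom : List A → List A → ℕ
  arcsFrom []       zs = 0
  arcsFrom (w ∷ ys) zs = outdegIn w zs + arcsFrom ys zs

  arcsFrom-∷ : ∀ x zs ys → arcsFrom ys (x ∷ zs) ≡ indegIn x ys + arcsFrom ys zs
  arcsFrom-∷ x zs []       = refl
  arcsFrom-∷ x zs (w ∷ ys) with R? w x
  ... | yes _ = cong suc (trans (cong (_+_ (outdegIn w zs)) (arcsFrom-∷ x zs ys))
                                (x∙yz≈y∙xz (outdegIn w zs) (indegIn x ys) (arcsFrom ys zs)))
  ... | no _  = trans (cong (_+_ (outdegIn w zs)) (arcsFrom-∷ x zs ys))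
                      (x∙yz≈y∙xz (outdegIn w zs) (indegIn x ys) (arcsFrom ys zs))

  -- Each element of a list on which R is semicomplete contributes at least
  -- the number of other elements, counting arcs in both directions: m² ≤ 2·arcs + m.
  arcsFrom-lower : (∀ x → ¬ R x x) → ∀ zs → Unique zs → SemiCompleteOn zs →
                   length zs * length zs ≤ 2 * arcsFrom zs zs + length zs
  arcsFrom-lower irr []       _                  _    = z≤n
  arcsFrom-lower irr (x ∷ xs) (x≢xs ∷ unique) semi = begin
    suc m * suc m                          ≡⟨ square m ⟩
    (m * m + m) + suc m                    ≤⟨ +-monoˡ-≤ (suc m) (+-monoˡ-≤ m ih) ⟩
    ((2 * a + m) + m) + suc m              ≤⟨ +-monoˡ-≤ (suc m) (+-mono-≤ (+-monoʳ-≤ (2 * a) covered) covered) ⟩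
    ((2 * a + (d + c)) + (d + c)) + suc m  ≡⟨ cong (λ t → t + suc m) (collect a d c) ⟩
    2 * (d + (c + a)) + suc m              ≡⟨ cong (λ t → 2 * t + suc m) (sym split) ⟩
    2 * arcsFrom (x ∷ xs) (x ∷ xs) + suc m ∎
    where
      open ≤-Reasoning
      m a d c : ℕ
      m = length xs
      a = arcsFrom xs xs
      d = outdegIn x xs
      c = indegIn x xs
      square : ∀ m → suc m * suc m ≡ (m * m + m) + suc m
      square = solve-∀
      collect : ∀ a d c → (2 * a + (d + c)) + (d + c) ≡ 2 * (d + (c + a))
      collect = solve-∀
      ih : m * m ≤ 2 * a + m
      ih = arcsFrom-lower irr xs unique (λ y∈ z∈ → semi (there y∈) (there z∈))
      covered : m ≤ d + c
      covered = length≤filter+filter (R? x) (λ w → R? w x)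
                (All.tabulate λ y∈ → semi (here refl) (there y∈) (All.lookup x≢xs y∈))
      split : arcsFrom (x ∷ xs) (x ∷ xs) ≡ d + (c + a)
      split = cong₂ _+_ (cong length (filter-reject (R? x) (irr x))) (arcsFrom-∷ x xs xs)

  arcsFrom-upper : ∀ m zs ys → All (λ w → 2 * outdegIn w zs + 1 ℕ.< m) ys →
                   2 * arcsFrom ys zs + 2 * length ys ≤ length ys * m
  arcsFrom-upper m zs []       []       = z≤n
  arcsFrom-upper m zs (w ∷ ys) (w-poor ∷ ys-poor) = begin
    2 * (d + a) + 2 * suc l            ≡⟨ split d a l ⟩
    suc (2 * d + 1) + (2 * a + 2 * l)  ≤⟨ +-mono-≤ w-poor (arcsFrom-upper m zs ys ys-poor) ⟩
    m + l * m                          ∎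
    where
      open ≤-Reasoning
      d a l : ℕ
      d = outdegIn w zs
      a = arcsFrom ys zs
      l = length ys
      split : ∀ d a l → 2 * (d + a) + 2 * suc l ≡ suc (2 * d + 1) + (2 * a + 2 * l)
      split = solve-∀

  averaging : (∀ x → ¬ R x x) → ∀ zs → Unique zs →
              SemiCompleteOn zs → 1 ≤ length zs →
              ∃[ w ] w List.∈ zs × length zs ≤ 2 * outdegIn w zs + 1
  averaging irr zs unique semi nonempty with Any.any? (λ w → length zs ≤? 2 * outdegIn w zs + 1) zs
  ... | yes rich = find rich
  ... | no ¬rich = contradiction nonempty (<⇒≱ (s≤s m≤0))
    where
      open ≤-Reasoning
      m a : ℕ
      m = length zs
      a = arcsFrom zs zs
      double : ∀ a m → (2 * a + m) + m ≡ 2 * a + 2 * m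
      double = solve-∀
      poor : All (λ w → 2 * outdegIn w zs + 1 ℕ.< m) zs
      poor = All.map ≰⇒> (¬Any⇒All¬ zs ¬rich)
      m≤0 : m ≤ 0
      m≤0 = +-cancelˡ-≤ (2 * a + m) m 0 (begin
        (2 * a + m) + m  ≡⟨ double a m ⟩
        2 * a + 2 * m    ≤⟨ arcsFrom-upper m zs zs poor ⟩
        m * m            ≤⟨ arcsFrom-lower irr zs unique semi ⟩
        2 * a + m        ≡⟨ sym (+-identityʳ (2 * a + m)) ⟩
        (2 * a + m) + 0  ∎)

no-loop : ∀ {n} (G : Digraph n) v → ¬ Arc G v v
no-loop G v a with trans (sym (loopless G v)) a
... | ()

arc? : ∀ {n} (G : Digraph n) u w → Dec (Arc G u w)
arc? G u w = arc G u w Bool.≟ true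

tournament : ∀ {n} (G : Digraph n) → SemiComplete G → (B : Subset n) → 1 ≤ ∣ B ∣ →
             ∃[ w ] w ∈ B × ∣ B ∣ ≤ 2 * ∣ outNbhd G w ∩ B ∣ + 1
tournament {n} G semi B 1≤∣B∣ =
  let w , w∈zs , rich = averaging (no-loop G) zs zs-unique (λ _ _ → semi _ _)
                                  (≤-trans 1≤∣B∣ ∣B∣≤∣zs∣)
  in w , proj₂ (∈-filter⁻ (_∈? B) {xs = allFin n} w∈zs) , (begin
       ∣ B ∣                          ≤⟨ ∣B∣≤∣zs∣ ⟩
       length zs                      ≤⟨ rich ⟩
       2 * outdegIn w zs + 1          ≤⟨ +-monoˡ-≤ 1 (*-monoʳ-≤ 2 (outdegIn≤ w)) ⟩
       2 * ∣ outNbhd G w ∩ B ∣ + 1    ∎)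
  where
    open ≤-Reasoning
    open Averaging (arc? G)
    zs : List (Fin n)
    zs = filter (_∈? B) (allFin n)
    zs-unique : Unique zs
    zs-unique = filter⁺ (_∈? B) (allFin⁺ n)
    ∣B∣≤∣zs∣ : ∣ B ∣ ≤ length zs
    ∣B∣≤∣zs∣ = ∣p∣≤length B zs (λ x∈B → ∈-filter⁺ (_∈? B) (∈-allFin _) x∈B)
    outdegIn≤ : ∀ w → outdegIn w zs ≤ ∣ outNbhd G w ∩ B ∣
    outdegIn≤ w = length≤∣p∣ (filter⁺ (arc? G w) zs-unique) (All.tabulate λ {u} u∈ →
      let u∈zs , a = ∈-filter⁻ (arc? G w) {xs = zs} u∈
      in x∈p∩q⁺ (∈-tabulate⁺ a , proj₂ (∈-filter⁻ (_∈? B) {xs = allFin n} u∈zs)))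

module _ {n} {G : Digraph n} (D : PathDecomposition G) where

  Index : Set
  Index = Fin (suc (r D))

  OnlyUpTo : Index → Fin n → Set
  OnlyUpTo e u = ∀ j → u ∈ bag D j → j Fin.≤ e

  onlyUpTo? : ∀ e u → Dec (OnlyUpTo e u)
  onlyUpTo? e u = all? λ j → (u ∈? bag D j) →-dec (j Fin.≤? e)

  SomeUpTo : Index → Fin n → Set
  SomeUpTo e u = ∃[ j ] j Fin.≤ e × u ∈ bag D j

  someUpTo? : ∀ e u → Dec (SomeUpTo e u)
  someUpTo? e u = any? λ j → (j Fin.≤? e) ×-dec (u ∈? bag D j)

  onlyUpTo⇒someUpTo : ∀ {e u} → OnlyUpTo e u → SomeUpTo e u
  onlyUpTo⇒someUpTo {u = u} only = let i , u∈i = cover D u in i , only i u∈i , u∈i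

  bag-between : ∀ {u i e j} → u ∈ bag D i → i Fin.≤ e → u ∈ bag D j → e Fin.≤ j → u ∈ bag D e
  bag-between {u} {i} {e} {j} u∈i i≤e u∈j e≤j with i ≟ e | e ≟ j
  ... | yes refl | _        = u∈i
  ... | no _     | yes refl = u∈j
  ... | no i≢e   | no e≢j   = interp D i e j (≤∧≢⇒< i≤e i≢e) (≤∧≢⇒< e≤j e≢j) u u∈i u∈j

  someUpTo⇒onlyUpTo⊎inBag : ∀ {e u} → SomeUpTo e u → OnlyUpTo e u ⊎ u ∈ bag D e
  someUpTo⇒onlyUpTo⊎inBag {e} {u} (i , i≤e , u∈i)
    with any? (λ j → (e Fin.<? j) ×-dec (u ∈? bag D j))
  ... | yes (j , e<j , u∈j) = inj₂ (bag-between u∈i i≤e u∈j (<⇒≤ e<j))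
  ... | no ¬later           = inj₁ λ j u∈j → ≮⇒≥ λ e<j → ¬later (j , e<j , u∈j)

  arc-from-onlyUpTo : ∀ {e u w} → OnlyUpTo e u → Arc G u w → SomeUpTo e w
  arc-from-onlyUpTo {u = u} {w} only uw with arcs D u w uw
  ... | inj₁ (i , u∈i , w∈i)           = i , only i u∈i , w∈i
  ... | inj₂ (i , j , j<i , u∈i , w∈j) = j , ≤-trans (<⇒≤ j<i) (only i u∈i) , w∈j

  arc-into-onlyUpTo : SemiComplete G → ∀ {e u w} → OnlyUpTo e u → ¬ SomeUpTo e w → Arc G w u
  arc-into-onlyUpTo semi {u = u} {w} only-u ¬some-w
    with semi w u (λ { refl → ¬some-w (onlyUpTo⇒someUpTo only-u) })
  ... | inj₁ wu = wu
  ... | inj₂ uw = contradiction (arc-from-onlyUpTo only-u uw) ¬some-w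

  lastBag : ∀ u → ∃[ l ] u ∈ bag D l × OnlyUpTo l u
  lastBag u = greatest (λ j → u ∈? bag D j) (cover D u)

  -- The pivot of a nonempty vertex set X: the earliest index e that is the
  -- last bag of some v ∈ X; every vertex of X then still occurs at or after e.
  record Pivot (X : Subset n) : Set where
    field
      e      : Index
      v      : Fin n
      v∈X    : v ∈ X
      v∈We   : v ∈ bag D e
      v-only : OnlyUpTo e v
      X-late : ∀ {x} → x ∈ X → ∃[ j ] e Fin.≤ j × x ∈ bag D j

  pivot : ∀ X → Nonempty X → Pivot X
  pivot X (x₀ , x₀∈X) =
    let e , (v , v∈X , v∈We , v-only) , e-least = least lastOfX? (_ , lastOf x₀∈X)
    in record { e = e ; v = v ; v∈X = v∈X ; v∈We = v∈We ; v-only = v-only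
              ; X-late = λ {x} x∈X → let l , x∈l , _ = lastBag x
                                     in l , e-least l (lastOf x∈X) , x∈l }
    where
      LastOfX : Index → Set
      LastOfX l = ∃[ x ] x ∈ X × x ∈ bag D l × OnlyUpTo l x
      lastOfX? : ∀ l → Dec (LastOfX l)
      lastOfX? l = any? λ x → (x ∈? X) ×-dec (x ∈? bag D l) ×-dec onlyUpTo? l x
      lastOf : ∀ {x} → x ∈ X → LastOfX (proj₁ (lastBag x))
      lastOf {x} x∈X = let _ , x∈l , x-only = lastBag x in x , x∈X , x∈l , x-only

module NoNarrowDecomposition {n} (T : Digraph n) (k : ℕ) (semi : SemiComplete T)
    (X : Subset n) (tangle : IsDegreeTangle T (5 * k + 2) k X)
    (D : PathDecomposition T) (narrow : ∀ i → ∣ bag D i ∣ ≤ suc k) where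

  X-large : 5 * k + 2 ≤ ∣ X ∣
  X-large = proj₁ tangle

  X-nonempty : Nonempty X
  X-nonempty = nonempty X (≤-trans (≤-trans (s≤s z≤n) (m≤n+m 2 (5 * k))) X-large)

  open Pivot (pivot D X X-nonempty)

  W : Subset n
  W = bag D e

  L : Subset n
  L = ⟦ onlyUpTo? D e ⟧

  IsLate : Fin n → Set
  IsLate u = u ∈ X × ¬ SomeUpTo D e u

  isLate? : ∀ u → Dec (IsLate u)
  isLate? u = (u ∈? X) ×-dec ¬? (someUpTo? D e u)

  B : Subset n
  B = ⟦ isLate? ⟧

  -- Out-neighbours of v meet a bag up to e, so N⁺(v) ⊆ (L - v) ∪ (W - v).
  v-bound : suc (outdeg T v) ≤ ∣ L ∣ + k
  v-bound = begin
    suc (outdeg T v)            ≤⟨ s≤s (p⊆q⇒∣p∣≤∣q∣ out⊆) ⟩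
    suc ∣ (L - v) ∪ (W - v) ∣   ≤⟨ s≤s (∣p∪q∣≤∣p∣+∣q∣ (L - v) (W - v)) ⟩
    suc ∣ L - v ∣ + ∣ W - v ∣   ≤⟨ +-monoˡ-≤ ∣ W - v ∣ (x∈p⇒∣p-x∣<∣p∣ (∈⟦⟧⁺ (onlyUpTo? D e) v-only)) ⟩
    ∣ L ∣ + ∣ W - v ∣           ≤⟨ +-monoʳ-≤ ∣ L ∣ ∣W-v∣≤k ⟩
    ∣ L ∣ + k                   ∎
    where
      open ≤-Reasoning
      ∣W-v∣≤k : ∣ W - v ∣ ≤ k
      ∣W-v∣≤k = ≤-pred (≤-trans (x∈p⇒∣p-x∣<∣p∣ v∈We) (narrow e))
      out⊆ : ∀ {u} → u ∈ outNbhd T v → u ∈ (L - v) ∪ (W - v)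
      out⊆ {u} u∈ = x∈p∪q⁺ (Sum.map (λ u-only → x∈p∧x≢y⇒x∈p-y (∈⟦⟧⁺ (onlyUpTo? D e) u-only) u≢v)
                                    (λ u∈W → x∈p∧x≢y⇒x∈p-y u∈W u≢v)
                                    (someUpTo⇒onlyUpTo⊎inBag D (arc-from-onlyUpTo D v-only vu)))
        where
          vu : Arc T v u
          vu = ∈-tabulate⁻ u∈
          u≢v : u ≢ v
          u≢v refl = no-loop T v vu

  -- Tangle vertices meeting a bag up to e lie in W, as they also occur at or after e.
  X⊆W∪B : ∀ {x} → x ∈ X → x ∈ W ∪ B
  X⊆W∪B {x} x∈X with someUpTo? D e x
  ... | yes (i , i≤e , x∈i) = let j , e≤j , x∈j = X-late x∈X
                              in x∈p∪q⁺ (inj₁ (bag-between D x∈i i≤e x∈j e≤j))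
  ... | no ¬some           = x∈p∪q⁺ (inj₂ (∈⟦⟧⁺ isLate? (x∈X , ¬some)))

  B-large : 4 * k + 1 ≤ ∣ B ∣
  B-large = +-cancelˡ-≤ (suc k) (4 * k + 1) ∣ B ∣ (begin
    suc k + (4 * k + 1)  ≡⟨ regroup k ⟩
    5 * k + 2            ≤⟨ X-large ⟩
    ∣ X ∣                ≤⟨ p⊆q⇒∣p∣≤∣q∣ X⊆W∪B ⟩
    ∣ W ∪ B ∣            ≤⟨ ∣p∪q∣≤∣p∣+∣q∣ W B ⟩
    ∣ W ∣ + ∣ B ∣        ≤⟨ +-monoˡ-≤ ∣ B ∣ (narrow e) ⟩
    suc k + ∣ B ∣        ∎)
    where
      open ≤-Reasoning
      regroup : ∀ k → suc k + (4 * k + 1) ≡ 5 * k + 2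
      regroup = solve-∀

  -- A vertex w ∈ B dominates L, which is disjoint from B.
  w-bound : ∀ {w} → w ∈ B → ∣ L ∣ + ∣ outNbhd T w ∩ B ∣ ≤ outdeg T w
  w-bound {w} w∈B = begin
    ∣ L ∣ + ∣ N ∩ B ∣  ≡⟨ ∣p∣+∣q∣≡∣p∪q∣ L (N ∩ B) disjoint ⟩
    ∣ L ∪ (N ∩ B) ∣    ≤⟨ p⊆q⇒∣p∣≤∣q∣ (λ u∈ → [ dominated , proj₁ ∘ x∈p∩q⁻ N B ] (x∈p∪q⁻ L (N ∩ B) u∈)) ⟩
    ∣ N ∣              ∎
    where
      open ≤-Reasoning
      N : Subset n
      N = outNbhd T w
      w-late : ¬ SomeUpTo D e w
      w-late = proj₂ (∈⟦⟧⁻ isLate? w∈B)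
      dominated : ∀ {u} → u ∈ L → u ∈ N
      dominated u∈L = ∈-tabulate⁺ (arc-into-onlyUpTo D semi (∈⟦⟧⁻ (onlyUpTo? D e) u∈L) w-late)
      disjoint : Empty (L ∩ (N ∩ B))
      disjoint (u , u∈) =
        let u∈L , u∈N∩B = x∈p∩q⁻ L (N ∩ B) u∈
        in proj₂ (∈⟦⟧⁻ isLate? (proj₂ (x∈p∩q⁻ N B u∈N∩B)))
                 (onlyUpTo⇒someUpTo D (∈⟦⟧⁻ (onlyUpTo? D e) u∈L))

  no-rich-vertex : ∀ {w} → w ∈ B → ∣ B ∣ ≤ 2 * ∣ outNbhd T w ∩ B ∣ + 1 → ⊥
  no-rich-vertex {w} w∈B rich = <-irrefl refl (begin-strict
    outdeg T v + k    <⟨ +-monoˡ-< k v-bound ⟩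
    (∣ L ∣ + k) + k   ≡⟨ twice ∣ L ∣ k ⟩
    ∣ L ∣ + 2 * k     ≤⟨ +-monoʳ-≤ ∣ L ∣ (half k c (≤-trans B-large rich)) ⟩
    ∣ L ∣ + c         ≤⟨ w-bound w∈B ⟩
    outdeg T w        ≤⟨ m≤n+∣n-m∣ (outdeg T w) (outdeg T v) ⟩
    outdeg T v + dist (outdeg T v) (outdeg T w)
                      ≤⟨ +-monoʳ-≤ (outdeg T v) (proj₂ tangle v w v∈X (proj₁ (∈⟦⟧⁻ isLate? w∈B))) ⟩
    outdeg T v + k    ∎)
    where
      open ≤-Reasoning
      c : ℕ
      c = ∣ outNbhd T w ∩ B ∣
      twice : ∀ l k → (l + k) + k ≡ l + 2 * k
      twice = solve-∀
      half : ∀ k c → 4 * k + 1 ≤ 2 * c + 1 → 2 * k ≤ c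
      half k c le = *-cancelˡ-≤ 2 (≤-trans (≤-reflexive (quadruple k)) (+-cancelʳ-≤ 1 (4 * k) (2 * c) le))
        where
          quadruple : ∀ k → 2 * (2 * k) ≡ 4 * k
          quadruple = solve-∀

  impossible : ⊥
  impossible =
    let w , w∈B , rich = tournament T semi B (≤-trans (m≤n+m 1 (4 * k)) B-large)
    in no-rich-vertex w∈B rich

-- Integer notation for widths, opened only here: its prefix + would make the
-- natural-number expressions above ambiguous.
open import Data.Integer using (ℤ; +_; _<_)

∣bag∣≤maxBagSize : ∀ {n} {G : Digraph n} (D : PathDecomposition G) i → ∣ bag D i ∣ ≤ maxBagSize D
∣bag∣≤maxBagSize D i = ≤-foldr-⊔ (∈-map⁺ (λ j → ∣ bag D j ∣) (∈-allFin i))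
  where
    ≤-foldr-⊔ : ∀ {m ms} → m List.∈ ms → m ≤ foldr _⊔_ 0 ms
    ≤-foldr-⊔ {ms = m ∷ _}  (here refl) = m≤m⊔n m _
    ≤-foldr-⊔ {ms = m′ ∷ _} (there m∈) = ≤-trans (≤-foldr-⊔ m∈) (m≤n⊔m m′ _)

width≤⇒maxBagSize≤ : ∀ {n} {G : Digraph n} (D : PathDecomposition G) k →
                     width D ℤ.≤ + k → maxBagSize D ≤ suc k
width≤⇒maxBagSize≤ D k = bound (maxBagSize D)
  where
    bound : ∀ M → + M ℤ.- + 1 ℤ.≤ + k → M ≤ suc k
    bound zero    _  = z≤n
    bound (suc M) le = s≤s (ℤ.drop‿+≤+ le)

lemma10 : ∀ {n} (T : Digraph n) (k : ℕ) → SemiComplete T →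
    HasDegreeTangle T (5 * k + 2) k →
    ∀ (p : ℤ) → IsPathwidth T p → + k < p
lemma10 T k semi (X , tangle) p ((D , width≡p) , _) with + k ℤ.<? p
... | yes k<p = k<p
... | no  k≮p = ⊥-elim (NoNarrowDecomposition.impossible T k semi X tangle D narrow)
  where
    narrow : ∀ i → ∣ bag D i ∣ ≤ suc k
    narrow i = ≤-trans (∣bag∣≤maxBagSize D i)
                       (width≤⇒maxBagSize≤ D k (subst (ℤ._≤ + k) (sym width≡p) (ℤ.≮⇒≥ k≮p)))
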